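{- Let $\pi\in S_{n+1}$ have no fixed points. Then $\pi$ has no stretching pair (a pair $1\le i<j\le n+1$ with $\pi(i)<i<j<\pi(j)$) if and only if there exists $\ell\in[n]$ such that ${\rm Exc}(\pi)=[\ell]$, where ${\rm Exc}(\pi)=\{i:\pi(i)>i\}$.
   Context: $S_{n+1}$ is the set of permutations of $[n+1]$; $[\ell]=\{1,\dots,\ell\}$. -}

module Defs where

open import Data.Nat using (ℕ; suc; _<_; _≤_)
open import Data.Fin using (Fin; toℕ)
open import Data.Fin.Permutation using (Permutation′; _⟨$⟩ʳ_)
open import Data.Product using (Σ; ∃; ∃-syntax; _×_)
open import Relation.Binary.PropositionalEquality using (_≢_)
open import Function.Bundles using (_⇔_)
open import Relation.Nullary using (¬_)

-- S_{n+1} is modelled as Permutation′ (suc n), permutations of Fin (suc n);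
-- element i : Fin (suc n) stands for the integer toℕ i + 1 ∈ [n+1].
-- All comparisons are between elements, so the shift by one is harmless.

FixedPointFree : {m : ℕ} → Permutation′ m → Set
FixedPointFree {m} π = (i : Fin m) → π ⟨$⟩ʳ i ≢ i

IsExc : {m : ℕ} → Permutation′ m → Fin m → Set
IsExc π i = toℕ i < toℕ (π ⟨$⟩ʳ i)

IsStretchingPair : {m : ℕ} → Permutation′ m → Fin m → Fin m → Set
IsStretchingPair π i j =
  (toℕ i < toℕ j) × (toℕ (π ⟨$⟩ʳ i) < toℕ i) × (toℕ j < toℕ (π ⟨$⟩ʳ j))

HasStretchingPair : {m : ℕ} → Permutation′ m → Set
HasStretchingPair {m} π = Σ (Fin m) λ i → Σ (Fin m) λ j → IsStretchingPair π i j

-- Exc(π) = [ℓ] = {1,…,ℓ}; in 0-indexed form: i ∈ Exc(π) ⟺ toℕ i < ℓ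
ExcIsInitialSegment : {m : ℕ} → Permutation′ m → ℕ → Set
ExcIsInitialSegment {m} π ℓ = (i : Fin m) → IsExc π i ⇔ (toℕ i < ℓ)

module Submission where

-- (⇐) holds for every permutation: if Exc(π) = [ℓ] and (i , j) were a
--     stretching pair, then j ∈ Exc(π) forces i < j < ℓ, so i ∈ Exc(π),
--     contradicting π(i) < i.
-- (⇒) The last element is never an excedance, so there is a least
--     non-excedance d; fixed-point-freeness makes it a deficiency,
--     π(d) < d.  Every i < d is an excedance by minimality, and an
--     excedance i > d would make (d , i) a stretching pair, so Exc(π) = [d].
-- Bounds: the first element is an excedance (π(1) ≠ 1) and the last is not,
--     so any ℓ with Exc(π) = [ℓ] satisfies 1 ≤ ℓ ≤ n.

open import Defs
open import Data.Nat using (ℕ; suc; _≤_; _<_; _<?_)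
open import Data.Nat.Properties using (≤∧≢⇒<; ≮⇒≥; <⇒≱; <-trans; <-irrefl; <-cmp; n≮0)
open import Data.Fin using (Fin; zero; toℕ; fromℕ; fromℕ<; inject)
open import Data.Fin.Properties
  using (toℕ-injective; toℕ-fromℕ; toℕ-fromℕ<; toℕ-inject; toℕ≤pred[n]; ¬∀⟶∃¬-smallest)
open import Data.Fin.Permutation using (Permutation′; _⟨$⟩ʳ_)
open import Data.Product using (Σ; ∃; _×_; _,_)
open import Function.Bundles using (_⇔_; mk⇔; Equivalence)
open import Relation.Binary using (tri<; tri≈; tri>)
open import Relation.Binary.PropositionalEquality using (_≡_; refl; sym; trans; subst)
open import Relation.Nullary using (¬_)
open import Relation.Nullary.Decidable using (decidable-stable)
open import Relation.Unary using (Pred; Decidable)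
open import Data.Empty using (⊥-elim)
open import Level using (Level)

-- A decidable predicate on Fin m that fails somewhere has a least failure d:
-- it fails at d and holds at every j below d.  (The library version phrases
-- "below d" through Fin′ d; this restates it in terms of toℕ.)
leastFailure : {m : ℕ} {p : Level} (P : Pred (Fin m) p) → Decidable P →
  (k : Fin m) → ¬ P k →
  ∃ λ d → ¬ P d × ((j : Fin m) → toℕ j < toℕ d → P j)
leastFailure {m} P P? k ¬Pk with ¬∀⟶∃¬-smallest m P P? (λ all → ¬Pk (all k))
... | d , ¬Pd , belowHolds = d , ¬Pd , holdsBelow
  where
  holdsBelow : (j : Fin m) → toℕ j < toℕ d → P j
  holdsBelow j j<d = subst P injectBack (belowHolds (fromℕ< j<d))
    where
    injectBack : inject (fromℕ< j<d) ≡ j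
    injectBack = toℕ-injective (trans (toℕ-inject (fromℕ< j<d)) (toℕ-fromℕ< j<d))

module _ {m : ℕ} (π : Permutation′ m) where

  excedance? : Decidable (IsExc π)
  excedance? i = toℕ i <? toℕ (π ⟨$⟩ʳ i)

  nonExcedance⇒deficiency : FixedPointFree π → (i : Fin m) → ¬ IsExc π i →
    toℕ (π ⟨$⟩ʳ i) < toℕ i
  nonExcedance⇒deficiency fpf i ¬exc =
    ≤∧≢⇒< (≮⇒≥ ¬exc) (λ eq → fpf i (toℕ-injective eq))

  initialSegment⇒noStretchingPair : {ℓ : ℕ} → ExcIsInitialSegment π ℓ →
    ¬ HasStretchingPair π
  initialSegment⇒noStretchingPair {ℓ} seg (i , j , i<j , πi<i , j<πj) =
    <-irrefl refl (<-trans iExc πi<i)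
    where
    j<ℓ : toℕ j < ℓ
    j<ℓ = Equivalence.to (seg j) j<πj
    iExc : IsExc π i
    iExc = Equivalence.from (seg i) (<-trans i<j j<ℓ)

module _ {n : ℕ} (π : Permutation′ (suc n)) where

  lastIsNotExcedance : ¬ IsExc π (fromℕ n)
  lastIsNotExcedance exc = <⇒≱ exc
    (subst (toℕ (π ⟨$⟩ʳ fromℕ n) ≤_) (sym (toℕ-fromℕ n)) (toℕ≤pred[n] (π ⟨$⟩ʳ fromℕ n)))

  -- The first element is an excedance, since it cannot be a deficiency.
  firstIsExcedance : FixedPointFree π → IsExc π zero
  firstIsExcedance fpf = decidable-stable (excedance? π zero)
    (λ ¬exc → n≮0 (nonExcedance⇒deficiency π fpf zero ¬exc))

  -- (⇒) Without stretching pairs, Exc(π) is the segment below the least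
  -- non-excedance d: an excedance i > d would form the stretching pair (d , i).
  noStretchingPair⇒initialSegment : FixedPointFree π → ¬ HasStretchingPair π →
    Σ ℕ (ExcIsInitialSegment π)
  noStretchingPair⇒initialSegment fpf noPair
    with leastFailure (IsExc π) (excedance? π) (fromℕ n) lastIsNotExcedance
  ... | d , ¬excd , belowExc = toℕ d , λ i → mk⇔ (excBelow i) (belowExc i)
    where
    excBelow : (i : Fin (suc n)) → IsExc π i → toℕ i < toℕ d
    excBelow i exc with <-cmp (toℕ i) (toℕ d)
    ... | tri< i<d _ _ = i<d
    ... | tri≈ _ i≡d _ = ⊥-elim (¬excd (subst (IsExc π) (toℕ-injective i≡d) exc))
    ... | tri> _ _ d<i =
          ⊥-elim (noPair (d , i , d<i , nonExcedance⇒deficiency π fpf d ¬excd , exc))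

  -- Any initial segment [ℓ] equal to Exc(π) satisfies 1 ≤ ℓ ≤ n, because the
  -- first element is an excedance and the last is not.
  initialSegmentBounds : FixedPointFree π → {ℓ : ℕ} → ExcIsInitialSegment π ℓ →
    1 ≤ ℓ × ℓ ≤ n
  initialSegmentBounds fpf {ℓ} seg = Equivalence.to (seg zero) (firstIsExcedance fpf) , ℓ≤n
    where
    ℓ≤n : ℓ ≤ n
    ℓ≤n = ≮⇒≥ λ n<ℓ → lastIsNotExcedance
      (Equivalence.from (seg (fromℕ n)) (subst (_< ℓ) (sym (toℕ-fromℕ n)) n<ℓ))

mainTheorem8 : (n : ℕ) (π : Permutation′ (suc n)) → FixedPointFree π →
    (¬ HasStretchingPair π) ⇔ Σ ℕ (λ ℓ → (1 ≤ ℓ × ℓ ≤ n) × ExcIsInitialSegment π ℓ)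
mainTheorem8 n π fpf = mk⇔ segmentOf noPairOf
  where
  segmentOf : ¬ HasStretchingPair π →
    Σ ℕ (λ ℓ → (1 ≤ ℓ × ℓ ≤ n) × ExcIsInitialSegment π ℓ)
  segmentOf noPair with noStretchingPair⇒initialSegment π fpf noPair
  ... | ℓ , seg = ℓ , initialSegmentBounds π fpf seg , seg

  noPairOf : Σ ℕ (λ ℓ → (1 ≤ ℓ × ℓ ≤ n) × ExcIsInitialSegment π ℓ) →
    ¬ HasStretchingPair π
  noPairOf (_ , _ , seg) = initialSegment⇒noStretchingPair π seg
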